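{- The class of (countably infinite) binary successor trees is not punctually robust: there is a computable binary successor tree not isomorphic to any punctual binary successor tree.
   Context: A binary successor tree is a structure $\mathcal T=(T,S^1,S^2,e,r)$ with unary functions $S^1,S^2$ and constants $e$ (the empty node) and $r$ (the root) such that: (1) $S^1$ and $S^2$ have no cycles and each $S^i$ is injective on $T\setminus (S^i)^{ -1}(e)$; (2) $\mathrm{ran}(S^1)\cap\mathrm{ran}(S^2)=\{e\}$; (3) $\mathrm{ran}(S^1)\cup\mathrm{ran}(S^2)=T\setminus\{r\}$; (4) $S^1(e)=S^2(e)=e$. A structure is computable if its domain is a computable subset of $\mathbb N$ and its functions are computable; it is punctual if its domain is $\mathbb N$ and its functions are primitive recursive. A class is punctually robust if every computable member is isomorphic to a punctual structure. -}

module Defs where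

open import Data.Nat using (ℕ; zero; suc; _≤_; _<_)
open import Data.Fin using (Fin)
open import Data.Vec using (Vec; []; _∷_; lookup)
open import Data.Product using (Σ; ∃; _×_; _,_)
open import Data.Sum using (_⊎_)
open import Data.Unit using (⊤)
open import Relation.Nullary using (¬_)
open import Relation.Binary.PropositionalEquality using (_≡_; _≢_)

data PR : ℕ → Set where
  Z    : ∀ {n} → PR n
  S    : PR 1
  P    : ∀ {n} → Fin n → PR n
  C    : ∀ {m n} → PR m → Vec (PR n) m → PR n
  Rec  : ∀ {n} → PR n → PR (suc (suc n)) → PR (suc n)

mutual
  evalPR : ∀ {n} → PR n → Vec ℕ n → ℕ
  evalPR Z xs = 0
  evalPR S (x ∷ []) = suc x
  evalPR (P i) xs = lookup xs i
  evalPR (C f gs) xs = evalPR f (evalPRs gs xs)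
  evalPR (Rec g h) (zero ∷ xs) = evalPR g xs
  evalPR (Rec g h) (suc k ∷ xs) = evalPR h (k ∷ evalPR (Rec g h) (k ∷ xs) ∷ xs)

  evalPRs : ∀ {m n} → Vec (PR n) m → Vec ℕ n → Vec ℕ m
  evalPRs [] xs = []
  evalPRs (g ∷ gs) xs = evalPR g xs ∷ evalPRs gs xs

IsPrimRec : (ℕ → ℕ) → Set
IsPrimRec f = Σ (PR 1) λ p → ∀ x → evalPR p (x ∷ []) ≡ f x

data PRec : ℕ → Set where
  Z    : ∀ {n} → PRec n
  S    : PRec 1
  P    : ∀ {n} → Fin n → PRec n
  C    : ∀ {m n} → PRec m → Vec (PRec n) m → PRec n
  Rec  : ∀ {n} → PRec n → PRec (suc (suc n)) → PRec (suc n)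
  Mu   : ∀ {n} → PRec (suc n) → PRec n

mutual
  data _[_]⇓_ : ∀ {n} → PRec n → Vec ℕ n → ℕ → Set where
    ⇓Z   : ∀ {n} {xs : Vec ℕ n} → Z [ xs ]⇓ 0
    ⇓S   : ∀ {x} → S [ x ∷ [] ]⇓ suc x
    ⇓P   : ∀ {n} {i : Fin n} {xs} → P i [ xs ]⇓ lookup xs i
    ⇓C   : ∀ {m n} {f : PRec m} {gs : Vec (PRec n) m} {xs ys y} →
           gs [ xs ]⇓s ys → f [ ys ]⇓ y → C f gs [ xs ]⇓ y
    ⇓R0  : ∀ {n} {g : PRec n} {h xs y} →
           g [ xs ]⇓ y → Rec g h [ zero ∷ xs ]⇓ y
    ⇓RS  : ∀ {n} {g : PRec n} {h k xs z y} →
           Rec g h [ k ∷ xs ]⇓ z → h [ k ∷ z ∷ xs ]⇓ y →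
           Rec g h [ suc k ∷ xs ]⇓ y
    ⇓Mu  : ∀ {n} {f : PRec (suc n)} {xs y} →
           f [ y ∷ xs ]⇓ 0 →
           (∀ z → z < y → Σ ℕ λ k → f [ z ∷ xs ]⇓ suc k) →
           Mu f [ xs ]⇓ y

  data _[_]⇓s_ : ∀ {m n} → Vec (PRec n) m → Vec ℕ n → Vec ℕ m → Set where
    []  : ∀ {n} {xs : Vec ℕ n} → [] [ xs ]⇓s []
    _∷_ : ∀ {m n} {g : PRec n} {gs : Vec (PRec n) m} {xs y ys} →
          g [ xs ]⇓ y → gs [ xs ]⇓s ys → (g ∷ gs) [ xs ]⇓s (y ∷ ys)

IsComputable : (ℕ → ℕ) → Set
IsComputable f = Σ (PRec 1) λ p → ∀ x → p [ x ∷ [] ]⇓ f x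

IsComputableSet : (ℕ → Set) → Set
IsComputableSet A = Σ (ℕ → ℕ) λ χ →
  IsComputable χ × (∀ x → (A x → χ x ≡ 1) × (χ x ≡ 1 → A x))

record Str : Set₁ where
  field
    Dom  : ℕ → Set
    S¹   : ℕ → ℕ
    S²   : ℕ → ℕ
    e    : ℕ
    r    : ℕ
    e∈   : Dom e
    r∈   : Dom r
    S¹∈  : ∀ x → Dom x → Dom (S¹ x)
    S²∈  : ∀ x → Dom x → Dom (S² x)

open Str public

iter : (ℕ → ℕ) → ℕ → ℕ → ℕ
iter f zero x = x
iter f (suc n) x = f (iter f n x)

-- "S has no cycles": the only cycle is the forced loop S(e) = e
NoCycles : (A : Str) → (ℕ → ℕ) → Set
NoCycles A f = ∀ x → Dom A x → x ≢ e A → ∀ n → iter f (suc n) x ≢ x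

InjOffE : (A : Str) → (ℕ → ℕ) → Set
InjOffE A f = ∀ x y → Dom A x → Dom A y → f x ≢ e A → f y ≢ e A →
              f x ≡ f y → x ≡ y

record IsBST (A : Str) : Set where
  field
    noCyc¹ : NoCycles A (S¹ A)
    noCyc² : NoCycles A (S² A)
    inj¹   : InjOffE A (S¹ A)
    inj²   : InjOffE A (S² A)
    -- ran(S¹) ∩ ran(S²) = {e}  (e lies in both by (4))
    disj   : ∀ x y → Dom A x → Dom A y → S¹ A x ≡ S² A y → S¹ A x ≡ e A
    ranNoR : ∀ x → Dom A x → (S¹ A x ≢ r A) × (S² A x ≢ r A)
    ranAll : ∀ z → Dom A z → z ≢ r A →
             Σ ℕ λ x → Dom A x × ((S¹ A x ≡ z) ⊎ (S² A x ≡ z))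
    S¹e    : S¹ A (e A) ≡ e A
    S²e    : S² A (e A) ≡ e A

Infinite : (ℕ → Set) → Set
Infinite D = ∀ n → Σ ℕ λ m → n ≤ m × D m

-- computable: computable domain, computable functions
-- (a computable function on a computable domain D ⊆ ℕ is represented by a
--  total computable function on ℕ, which is no loss of generality)
IsComputableStr : Str → Set
IsComputableStr A = IsComputableSet (Dom A) × IsComputable (S¹ A) × IsComputable (S² A)

IsPunctualStr : Str → Set
IsPunctualStr A = (∀ x → Dom A x) × IsPrimRec (S¹ A) × IsPrimRec (S² A)

record _≅_ (A B : Str) : Set where
  field
    to      : ℕ → ℕ
    from    : ℕ → ℕ
    to∈     : ∀ x → Dom A x → Dom B (to x)
    from∈   : ∀ y → Dom B y → Dom A (from y)
    from-to : ∀ x → Dom A x → from (to x) ≡ x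
    to-from : ∀ y → Dom B y → to (from y) ≡ y
    pres-e  : to (e A) ≡ e B
    pres-r  : to (r A) ≡ r B
    pres-S¹ : ∀ x → Dom A x → to (S¹ A x) ≡ S¹ B (to x)
    pres-S² : ∀ x → Dom A x → to (S² A x) ≡ S² B (to x)

-- Let diag x be 1 if program number x outputs 0 on input x, and 0 otherwise.  It is
-- computable but not primitive recursive: it is computed by μ-search for the halting time
-- of a stack machine whose step function is primitive recursive on codes, and it differs
-- from every primitive recursive function at that function's own code.  Hang a leaf below
-- the n-th node of an infinite S¹-chain exactly when diag n ≡ 1.  The resulting tree is
-- computable because diag is; in an isomorphic copy with primitive recursive successors,
-- diag n is obtained primitively by taking n S¹-steps from the root and testing whether
-- the S²-successor is the empty node.

module Submission where

open import Defs
open import Data.Nat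
open import Data.Nat.Properties
open import Data.Fin using (Fin; zero; suc; toℕ; #_)
open import Data.Vec using (Vec; []; _∷_; lookup; tabulate; toList)
open import Data.Vec.Properties using (tabulate∘lookup)
open import Data.List using (List; []; _∷_)
open import Data.Product using (Σ; _×_; _,_; proj₁; proj₂)
open import Data.Sum using (_⊎_; inj₁; inj₂)
open import Relation.Nullary using (¬_; Dec; yes; no; contradiction)
open import Relation.Binary.PropositionalEquality
open import Relation.Binary.Construct.Closure.ReflexiveTransitive using (Star; ε; _◅_; _◅◅_)

ifz : {A : Set} → ℕ → A → A → A
ifz zero    a b = a
ifz (suc _) a b = b

ifz-distrib : {A B : Set} (f : A → B) (c : ℕ) (x y : A) → f (ifz c x y) ≡ ifz c (f x) (f y)
ifz-distrib f zero    x y = refl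
ifz-distrib f (suc c) x y = refl

ifz-nonzero : ∀ {A : Set} t {a b : A} → t ≢ 0 → ifz t a b ≡ b
ifz-nonzero zero    t≢0 = contradiction refl t≢0
ifz-nonzero (suc t) t≢0 = refl

iter-suc : ∀ (f : ℕ → ℕ) n x → iter f (suc n) x ≡ iter f n (f x)
iter-suc f zero    x = refl
iter-suc f (suc n) x = cong f (iter-suc f n x)

iter-+ : ∀ (f : ℕ → ℕ) m n x → iter f (m + n) x ≡ iter f m (iter f n x)
iter-+ f zero    n x = refl
iter-+ f (suc m) n x = cong f (iter-+ f m n x)

iter-fixed : ∀ (f : ℕ → ℕ) y → f y ≡ y → ∀ k → iter f k y ≡ y
iter-fixed f y fy≡y zero    = refl
iter-fixed f y fy≡y (suc k) = trans (cong f (iter-fixed f y fy≡y k)) fy≡y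

iter-cong : ∀ {f g : ℕ → ℕ} → (∀ y → f y ≡ g y) → ∀ n x → iter f n x ≡ iter g n x
iter-cong f≗g zero    x = refl
iter-cong {f} {g} f≗g (suc n) x = trans (f≗g (iter f n x)) (cong g (iter-cong f≗g n x))

least-witness : (Q : ℕ → Set) → (∀ k → Dec (Q k)) → ∀ n → Q n →
                Σ ℕ λ m → Q m × m ≤ n × (∀ k → k < m → ¬ Q k)
least-witness Q Q? zero    q = 0 , q , z≤n , λ _ ()
least-witness Q Q? (suc n) q with Q? 0
... | yes q0 = 0 , q0 , z≤n , λ _ ()
... | no ¬q0 with least-witness (λ k → Q (suc k)) (λ k → Q? (suc k)) n q
...   | m , qm , m≤n , below = suc m , qm , s≤s m≤n , below′
  where
  below′ : ∀ k → k < suc m → ¬ Q k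
  below′ zero    _         = ¬q0
  below′ (suc k) (s≤s k<m) = below k k<m

-- Cantor pairing

tri : ℕ → ℕ
tri zero    = 0
tri (suc k) = tri k + suc k

-- The largest d with tri d ≤ z.
triRoot : ℕ → ℕ
triRoot zero    = 0
triRoot (suc z) = ifz (tri (suc (triRoot z)) ∸ suc z) (suc (triRoot z)) (triRoot z)

tri-mono-≤ : ∀ {m n} → m ≤ n → tri m ≤ tri n
tri-mono-≤ {n = zero} z≤n = ≤-refl
tri-mono-≤ {m} {suc n} m≤1+n with m≤n⇒m<n∨m≡n m≤1+n
... | inj₁ (s≤s m≤n) = ≤-trans (tri-mono-≤ m≤n) (m≤m+n (tri n) (suc n))
... | inj₂ refl      = ≤-refl

n≤tri : ∀ n → n ≤ tri n
n≤tri zero    = z≤n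
n≤tri (suc n) = m≤n+m (suc n) (tri n)

Bracketed : ℕ → ℕ → Set
Bracketed z d = tri d ≤ z × z < tri (suc d)

bracketed-suc : ∀ {z d} → Bracketed z d →
  Bracketed (suc z) (ifz (tri (suc d) ∸ suc z) (suc d) d)
bracketed-suc {z} {d} (lo , hi) with tri (suc d) ∸ suc z in eq
... | zero  = tri[1+d]≤1+z , subst (λ w → suc z < w + suc (suc d)) (sym tri[1+d]≡1+z) (m<m+n (suc z) z<s)
  where
  tri[1+d]≤1+z : tri (suc d) ≤ suc z
  tri[1+d]≤1+z = m∸n≡0⇒m≤n eq
  tri[1+d]≡1+z : tri (suc d) ≡ suc z
  tri[1+d]≡1+z = ≤-antisym tri[1+d]≤1+z hi
... | suc _ = m≤n⇒m≤1+n lo , m∸n≢0⇒n<m (λ eq′ → 0≢1+n (trans (sym eq′) eq))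

triRoot-bracketed : ∀ z → Bracketed z (triRoot z)
triRoot-bracketed zero    = z≤n , s≤s z≤n
triRoot-bracketed (suc z) = bracketed-suc (triRoot-bracketed z)

bracketed-unique : ∀ {z d} → Bracketed z d → triRoot z ≡ d
bracketed-unique {z} {d} (lo , hi) = ≤-antisym (≮⇒≥ d≮root) (≮⇒≥ root≮d)
  where
  root : Bracketed z (triRoot z)
  root = triRoot-bracketed z
  d≮root : ¬ d < triRoot z
  d≮root d<r = <⇒≱ hi (≤-trans (tri-mono-≤ d<r) (proj₁ root))
  root≮d : ¬ triRoot z < d
  root≮d r<d = <⇒≱ (proj₂ root) (≤-trans (tri-mono-≤ r<d) lo)

-- Opaque, so that type checking never normalises pairs inside codes.
opaque
  pair : ℕ → ℕ → ℕ
  pair x y = tri (x + y) + y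

  π₂ : ℕ → ℕ
  π₂ z = z ∸ tri (triRoot z)

  π₁ : ℕ → ℕ
  π₁ z = triRoot z ∸ π₂ z

  triRoot-pair : ∀ x y → triRoot (pair x y) ≡ x + y
  triRoot-pair x y = bracketed-unique
    (m≤m+n (tri (x + y)) y , +-monoʳ-< (tri (x + y)) (s≤s (m≤n+m y x)))

  π₂-pair : ∀ x y → π₂ (pair x y) ≡ y
  π₂-pair x y = begin
    pair x y ∸ tri (triRoot (pair x y)) ≡⟨ cong (λ d → pair x y ∸ tri d) (triRoot-pair x y) ⟩
    tri (x + y) + y ∸ tri (x + y)       ≡⟨ m+n∸m≡n (tri (x + y)) y ⟩
    y                                   ∎
    where open ≡-Reasoning

  π₁-pair : ∀ x y → π₁ (pair x y) ≡ x
  π₁-pair x y = trans (cong₂ _∸_ (triRoot-pair x y) (π₂-pair x y)) (m+n∸n≡m x y)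

  π₂≤triRoot : ∀ z → π₂ z ≤ triRoot z
  π₂≤triRoot z = <⇒≤pred (subst (z ∸ tri d <_) (m+n∸m≡n (tri d) (suc d)) (∸-monoˡ-< hi lo))
    where
    d : ℕ
    d = triRoot z
    lo : tri d ≤ z
    lo = proj₁ (triRoot-bracketed z)
    hi : z < tri (suc d)
    hi = proj₂ (triRoot-bracketed z)

  pair-π : ∀ z → pair (π₁ z) (π₂ z) ≡ z
  pair-π z = trans (cong (λ d → tri d + π₂ z) (m∸n+n≡m (π₂≤triRoot z)))
                   (m+[n∸m]≡n (proj₁ (triRoot-bracketed z)))

  π₁≤ : ∀ z → π₁ z ≤ z
  π₁≤ z = ≤-trans (m∸n≤m (triRoot z) (π₂ z))
                  (≤-trans (n≤tri (triRoot z)) (proj₁ (triRoot-bracketed z)))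

  π₂≤ : ∀ z → π₂ z ≤ z
  π₂≤ z = m∸n≤m z (tri (triRoot z))

pair-π-at : ∀ {z t} → π₂ z ≡ t → pair (π₁ z) t ≡ z
pair-π-at {z} refl = pair-π z

pair-injective : ∀ {a b c d} → pair a b ≡ pair c d → a ≡ c × b ≡ d
pair-injective {a} {b} {c} {d} eq =
  trans (sym (π₁-pair a b)) (trans (cong π₁ eq) (π₁-pair c d)) ,
  trans (sym (π₂-pair a b)) (trans (cong π₂ eq) (π₂-pair c d))

≤-pairˡ : ∀ x y → x ≤ pair x y
≤-pairˡ x y = subst (_≤ pair x y) (π₁-pair x y) (π₁≤ (pair x y))

≤-pairʳ : ∀ x y → y ≤ pair x y
≤-pairʳ x y = subst (_≤ pair x y) (π₂-pair x y) (π₂≤ (pair x y))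

predᴾ : PR 1
predᴾ = Rec Z (P (# 0))

predᴾ-correct : ∀ k → evalPR predᴾ (k ∷ []) ≡ pred k
predᴾ-correct zero    = refl
predᴾ-correct (suc k) = refl

addᴾ : PR 2
addᴾ = Rec (P (# 0)) (C S (P (# 1) ∷ []))

addᴾ-correct : ∀ k y → evalPR addᴾ (k ∷ y ∷ []) ≡ k + y
addᴾ-correct zero    y = refl
addᴾ-correct (suc k) y = cong suc (addᴾ-correct k y)

flippedMonusᴾ : PR 2
flippedMonusᴾ = Rec (P (# 0)) (C predᴾ (P (# 1) ∷ []))

flippedMonusᴾ-correct : ∀ k y → evalPR flippedMonusᴾ (k ∷ y ∷ []) ≡ y ∸ k
flippedMonusᴾ-correct zero    y = refl
flippedMonusᴾ-correct (suc k) y =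
  trans (predᴾ-correct (evalPR flippedMonusᴾ (k ∷ y ∷ [])))
        (trans (cong pred (flippedMonusᴾ-correct k y)) (pred[m∸n]≡m∸[1+n] y k))

monusᴾ : PR 2
monusᴾ = C flippedMonusᴾ (P (# 1) ∷ P (# 0) ∷ [])

monusᴾ-correct : ∀ x y → evalPR monusᴾ (x ∷ y ∷ []) ≡ x ∸ y
monusᴾ-correct x y = flippedMonusᴾ-correct y x

ifzᴾ : PR 3
ifzᴾ = Rec (P (# 0)) (P (# 3))

ifzᴾ-correct : ∀ c a b → evalPR ifzᴾ (c ∷ a ∷ b ∷ []) ≡ ifz c a b
ifzᴾ-correct zero    a b = refl
ifzᴾ-correct (suc c) a b = refl

triᴾ : PR 1
triᴾ = Rec Z (C addᴾ (P (# 1) ∷ C S (P (# 0) ∷ []) ∷ []))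

triᴾ-correct : ∀ k → evalPR triᴾ (k ∷ []) ≡ tri k
triᴾ-correct zero    = refl
triᴾ-correct (suc k) =
  trans (addᴾ-correct (evalPR triᴾ (k ∷ [])) (suc k)) (cong (_+ suc k) (triᴾ-correct k))

triRootᴾ : PR 1
triRootᴾ = Rec Z (C ifzᴾ (C monusᴾ (C triᴾ (C S (P (# 1) ∷ []) ∷ []) ∷ C S (P (# 0) ∷ []) ∷ [])
                       ∷ C S (P (# 1) ∷ []) ∷ P (# 1) ∷ []))

triRootᴾ-correct : ∀ z → evalPR triRootᴾ (z ∷ []) ≡ triRoot z
triRootᴾ-correct zero = refl
triRootᴾ-correct (suc z)
  with d ← evalPR triRootᴾ (z ∷ []) in eq
  rewrite ifzᴾ-correct (evalPR monusᴾ (evalPR triᴾ (suc d ∷ []) ∷ suc z ∷ [])) (suc d) d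
        | monusᴾ-correct (evalPR triᴾ (suc d ∷ [])) (suc z)
        | triᴾ-correct (suc d)
        | trans (sym eq) (triRootᴾ-correct z) = refl

pairᴾ : PR 2
pairᴾ = C addᴾ (C triᴾ (C addᴾ (P (# 0) ∷ P (# 1) ∷ []) ∷ []) ∷ P (# 1) ∷ [])

π₂ᴾ : PR 1
π₂ᴾ = C monusᴾ (P (# 0) ∷ C triᴾ (C triRootᴾ (P (# 0) ∷ []) ∷ []) ∷ [])

π₁ᴾ : PR 1
π₁ᴾ = C monusᴾ (C triRootᴾ (P (# 0) ∷ []) ∷ π₂ᴾ ∷ [])

opaque
  unfolding pair

  pairᴾ-correct : ∀ x y → evalPR pairᴾ (x ∷ y ∷ []) ≡ pair x y
  pairᴾ-correct x y
    rewrite addᴾ-correct (evalPR triᴾ (evalPR addᴾ (x ∷ y ∷ []) ∷ [])) y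
          | addᴾ-correct x y
          | triᴾ-correct (x + y) = refl

  π₂ᴾ-correct : ∀ z → evalPR π₂ᴾ (z ∷ []) ≡ π₂ z
  π₂ᴾ-correct z
    rewrite monusᴾ-correct z (evalPR triᴾ (evalPR triRootᴾ (z ∷ []) ∷ []))
          | triRootᴾ-correct z
          | triᴾ-correct (triRoot z) = refl

  π₁ᴾ-correct : ∀ z → evalPR π₁ᴾ (z ∷ []) ≡ π₁ z
  π₁ᴾ-correct z = trans (monusᴾ-correct (evalPR triRootᴾ (z ∷ [])) (evalPR π₂ᴾ (z ∷ [])))
                        (cong₂ _∸_ (triRootᴾ-correct z) (π₂ᴾ-correct z))

data Expr : ℕ → Set where
  var            : ∀ {n} → Fin n → Expr n
  lit            : ∀ {n} → ℕ → Expr n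
  `suc `pred     : ∀ {n} → Expr n → Expr n
  `π₁ `π₂        : ∀ {n} → Expr n → Expr n
  `pair _`∸_     : ∀ {n} → Expr n → Expr n → Expr n
  `ifz           : ∀ {n} → Expr n → Expr n → Expr n → Expr n
  call           : ∀ {m n} → Expr m → Vec (Expr n) m → Expr n
  prog           : ∀ {n} → PR 1 → Expr n → Expr n
  `iter          : ∀ {n} → Expr n → Expr n → Expr (suc n) → Expr n

mutual
  ⟦_⟧ : ∀ {n} → Expr n → Vec ℕ n → ℕ
  ⟦ var i ⟧      xs = lookup xs i
  ⟦ lit k ⟧      xs = k
  ⟦ `suc a ⟧     xs = suc (⟦ a ⟧ xs)
  ⟦ `pred a ⟧    xs = pred (⟦ a ⟧ xs)
  ⟦ `π₁ a ⟧      xs = π₁ (⟦ a ⟧ xs)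
  ⟦ `π₂ a ⟧      xs = π₂ (⟦ a ⟧ xs)
  ⟦ `pair a b ⟧  xs = pair (⟦ a ⟧ xs) (⟦ b ⟧ xs)
  ⟦ a `∸ b ⟧     xs = ⟦ a ⟧ xs ∸ ⟦ b ⟧ xs
  ⟦ `ifz c a b ⟧ xs = ifz (⟦ c ⟧ xs) (⟦ a ⟧ xs) (⟦ b ⟧ xs)
  ⟦ call f as ⟧  xs = ⟦ f ⟧ (⟦ as ⟧* xs)
  ⟦ prog p a ⟧   xs = evalPR p (⟦ a ⟧ xs ∷ [])
  ⟦ `iter k x f ⟧ xs = iter (λ s → ⟦ f ⟧ (s ∷ xs)) (⟦ k ⟧ xs) (⟦ x ⟧ xs)

  ⟦_⟧* : ∀ {m n} → Vec (Expr n) m → Vec ℕ n → Vec ℕ m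
  ⟦ [] ⟧*     xs = []
  ⟦ a ∷ as ⟧* xs = ⟦ a ⟧ xs ∷ ⟦ as ⟧* xs

litᴾ : ∀ {n} → ℕ → PR n
litᴾ zero    = Z
litᴾ (suc k) = C S (litᴾ k ∷ [])

litᴾ-correct : ∀ {n} k (xs : Vec ℕ n) → evalPR (litᴾ k) xs ≡ k
litᴾ-correct zero    xs = refl
litᴾ-correct (suc k) xs = cong suc (litᴾ-correct k xs)

projections : ∀ {m n} → (Fin m → Fin n) → Vec (PR n) m
projections g = tabulate (λ i → P (g i))

projections-correct : ∀ {m n} (g : Fin m → Fin n) (ys : Vec ℕ n) →
                      evalPRs (projections g) ys ≡ tabulate (λ i → lookup ys (g i))
projections-correct {zero}  g ys = refl
projections-correct {suc m} g ys = cong (lookup ys (g zero) ∷_) (projections-correct (λ i → g (suc i)) ys)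

mutual
  compile : ∀ {n} → Expr n → PR n
  compile (var i)      = P i
  compile (lit k)      = litᴾ k
  compile (`suc a)     = C S (compile a ∷ [])
  compile (`pred a)    = C predᴾ (compile a ∷ [])
  compile (`π₁ a)      = C π₁ᴾ (compile a ∷ [])
  compile (`π₂ a)      = C π₂ᴾ (compile a ∷ [])
  compile (`pair a b)  = C pairᴾ (compile a ∷ compile b ∷ [])
  compile (a `∸ b)     = C monusᴾ (compile a ∷ compile b ∷ [])
  compile (`ifz c a b) = C ifzᴾ (compile c ∷ compile a ∷ compile b ∷ [])
  compile (call f as)  = C (compile f) (compile* as)
  compile (prog p a)   = C p (compile a ∷ [])
  compile (`iter k x f) = C (iterᴾ x f) (compile k ∷ projections (λ i → i))

  compile* : ∀ {m n} → Vec (Expr n) m → Vec (PR n) m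
  compile* []       = []
  compile* (a ∷ as) = compile a ∷ compile* as

  iterᴾ : ∀ {n} → Expr n → Expr (suc n) → PR (suc n)
  iterᴾ x f = Rec (compile x) (C (compile f) (P (# 1) ∷ projections (λ i → suc (suc i))))

mutual
  compile-correct : ∀ {n} (e : Expr n) (xs : Vec ℕ n) → evalPR (compile e) xs ≡ ⟦ e ⟧ xs
  compile-correct (var i)      xs = refl
  compile-correct (lit k)      xs = litᴾ-correct k xs
  compile-correct (`suc a)     xs = cong suc (compile-correct a xs)
  compile-correct (`pred a)    xs =
    trans (predᴾ-correct (evalPR (compile a) xs)) (cong pred (compile-correct a xs))
  compile-correct (`π₁ a)      xs =
    trans (π₁ᴾ-correct (evalPR (compile a) xs)) (cong π₁ (compile-correct a xs))
  compile-correct (`π₂ a)      xs =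
    trans (π₂ᴾ-correct (evalPR (compile a) xs)) (cong π₂ (compile-correct a xs))
  compile-correct (`pair a b)  xs =
    trans (pairᴾ-correct (evalPR (compile a) xs) (evalPR (compile b) xs))
          (cong₂ pair (compile-correct a xs) (compile-correct b xs))
  compile-correct (a `∸ b)     xs =
    trans (monusᴾ-correct (evalPR (compile a) xs) (evalPR (compile b) xs))
          (cong₂ _∸_ (compile-correct a xs) (compile-correct b xs))
  compile-correct (`ifz c a b) xs =
    trans (ifzᴾ-correct (evalPR (compile c) xs) (evalPR (compile a) xs) (evalPR (compile b) xs))
          (cong₃ ifz (compile-correct c xs) (compile-correct a xs) (compile-correct b xs))
    where
    cong₃ : ∀ (f : ℕ → ℕ → ℕ → ℕ) {a b c a′ b′ c′} →
            a ≡ a′ → b ≡ b′ → c ≡ c′ → f a b c ≡ f a′ b′ c′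
    cong₃ f refl refl refl = refl
  compile-correct (call f as)  xs =
    trans (cong (evalPR (compile f)) (compile*-correct as xs)) (compile-correct f (⟦ as ⟧* xs))
  compile-correct (prog p a)   xs = cong (λ v → evalPR p (v ∷ [])) (compile-correct a xs)
  compile-correct (`iter k x f) xs
    rewrite projections-correct (λ i → i) xs | tabulate∘lookup xs | compile-correct k xs =
      iterᴾ-correct x f xs (⟦ k ⟧ xs)

  compile*-correct : ∀ {m n} (as : Vec (Expr n) m) (xs : Vec ℕ n) →
                     evalPRs (compile* as) xs ≡ ⟦ as ⟧* xs
  compile*-correct []       xs = refl
  compile*-correct (a ∷ as) xs = cong₂ _∷_ (compile-correct a xs) (compile*-correct as xs)

  iterᴾ-correct : ∀ {n} x f (xs : Vec ℕ n) k →
                  evalPR (iterᴾ x f) (k ∷ xs) ≡ iter (λ s → ⟦ f ⟧ (s ∷ xs)) k (⟦ x ⟧ xs)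
  iterᴾ-correct x f xs zero = compile-correct x xs
  iterᴾ-correct x f xs (suc k)
    rewrite projections-correct (λ i → suc (suc i)) (k ∷ evalPR (iterᴾ x f) (k ∷ xs) ∷ xs)
          | tabulate∘lookup xs
          | iterᴾ-correct x f xs k = compile-correct f _

mutual
  toPRec : ∀ {n} → PR n → PRec n
  toPRec Z         = Z
  toPRec S         = S
  toPRec (P i)     = P i
  toPRec (C f gs)  = C (toPRec f) (toPRec* gs)
  toPRec (Rec g h) = Rec (toPRec g) (toPRec h)

  toPRec* : ∀ {m n} → Vec (PR n) m → Vec (PRec n) m
  toPRec* []       = []
  toPRec* (g ∷ gs) = toPRec g ∷ toPRec* gs

mutual
  toPRec-correct : ∀ {n} (p : PR n) xs → toPRec p [ xs ]⇓ evalPR p xs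
  toPRec-correct Z         xs       = ⇓Z
  toPRec-correct S         (x ∷ []) = ⇓S
  toPRec-correct (P i)     xs       = ⇓P
  toPRec-correct (C f gs)  xs       = ⇓C (toPRec*-correct gs xs) (toPRec-correct f (evalPRs gs xs))
  toPRec-correct (Rec g h) (k ∷ xs) = recursion k
    where
    recursion : ∀ k → Rec (toPRec g) (toPRec h) [ k ∷ xs ]⇓ evalPR (Rec g h) (k ∷ xs)
    recursion zero    = ⇓R0 (toPRec-correct g xs)
    recursion (suc k) = ⇓RS (recursion k) (toPRec-correct h (k ∷ evalPR (Rec g h) (k ∷ xs) ∷ xs))

  toPRec*-correct : ∀ {m n} (gs : Vec (PR n) m) xs → toPRec* gs [ xs ]⇓s evalPRs gs xs
  toPRec*-correct []       xs = []
  toPRec*-correct (g ∷ gs) xs = toPRec-correct g xs ∷ toPRec*-correct gs xs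

compute : ∀ {n} → Expr n → PRec n
compute e = toPRec (compile e)

compute-correct : ∀ {n} (e : Expr n) xs {v} → ⟦ e ⟧ xs ≡ v → compute e [ xs ]⇓ v
compute-correct e xs refl = subst (compute e [ xs ]⇓_) (compile-correct e xs) (toPRec-correct (compile e) xs)

-- Codes of programs

-- Lists of numbers as numbers; the list operations return 0 where undefined.

consN : ℕ → ℕ → ℕ
consN a b = suc (pair a b)

headN tailN : ℕ → ℕ
headN x = ifz x 0 (π₁ (pred x))
tailN x = ifz x 0 (π₂ (pred x))

nthN : ℕ → ℕ → ℕ
nthN i x = headN (iter tailN i x)

encodeList : List ℕ → ℕ
encodeList []       = 0
encodeList (x ∷ xs) = consN x (encodeList xs)

hd : List ℕ → ℕ
hd []      = 0
hd (x ∷ _) = x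

tl : List ℕ → List ℕ
tl []       = []
tl (_ ∷ xs) = xs

nth : ℕ → List ℕ → ℕ
nth _       []       = 0
nth zero    (x ∷ _)  = x
nth (suc i) (_ ∷ xs) = nth i xs

headN-consN : ∀ a b → headN (consN a b) ≡ a
headN-consN = π₁-pair

tailN-consN : ∀ a b → tailN (consN a b) ≡ b
tailN-consN = π₂-pair

headN-encode : ∀ l → headN (encodeList l) ≡ hd l
headN-encode []      = refl
headN-encode (x ∷ l) = headN-consN x (encodeList l)

tailN-encode : ∀ l → tailN (encodeList l) ≡ encodeList (tl l)
tailN-encode []      = refl
tailN-encode (x ∷ l) = tailN-consN x (encodeList l)

nthN-encode : ∀ i l → nthN i (encodeList l) ≡ nth i l
nthN-encode i       []      = cong headN (iter-fixed tailN 0 refl i)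
nthN-encode zero    (x ∷ l) = headN-consN x (encodeList l)
nthN-encode (suc i) (x ∷ l) = begin
  headN (iter tailN (suc i) (consN x (encodeList l))) ≡⟨ cong headN (iter-suc tailN i _) ⟩
  headN (iter tailN i (tailN (consN x (encodeList l)))) ≡⟨ cong (λ y → nthN i y) (tailN-consN x _) ⟩
  nthN i (encodeList l)                                 ≡⟨ nthN-encode i l ⟩
  nth i l                                               ∎
  where open ≡-Reasoning

-- Untyped programs act on argument lists of any length; missing arguments read as 0.

data UPR : Set where
  uZ uS : UPR
  uP    : ℕ → UPR
  uC    : UPR → List UPR → UPR
  uRec  : UPR → UPR → UPR

mutual
  evalU : UPR → List ℕ → ℕ
  evalU uZ         xs = 0
  evalU uS         xs = suc (hd xs)
  evalU (uP i)     xs = nth i xs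
  evalU (uC f gs)  xs = evalU f (evalU* gs xs)
  evalU (uRec g h) xs = evalRec g h (hd xs) (tl xs)

  evalU* : List UPR → List ℕ → List ℕ
  evalU* []       xs = []
  evalU* (g ∷ gs) xs = evalU g xs ∷ evalU* gs xs

  evalRec : UPR → UPR → ℕ → List ℕ → ℕ
  evalRec g h zero    xs = evalU g xs
  evalRec g h (suc k) xs = evalU h (k ∷ evalRec g h k xs ∷ xs)

mutual
  erase : ∀ {n} → PR n → UPR
  erase Z         = uZ
  erase S         = uS
  erase (P i)     = uP (toℕ i)
  erase (C f gs)  = uC (erase f) (erase* gs)
  erase (Rec g h) = uRec (erase g) (erase h)

  erase* : ∀ {m n} → Vec (PR n) m → List UPR
  erase* []       = []
  erase* (g ∷ gs) = erase g ∷ erase* gs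

nth-toList : ∀ {n} (xs : Vec ℕ n) i → nth (toℕ i) (toList xs) ≡ lookup xs i
nth-toList (x ∷ xs) zero    = refl
nth-toList (x ∷ xs) (suc i) = nth-toList xs i

mutual
  erase-correct : ∀ {n} (p : PR n) xs → evalU (erase p) (toList xs) ≡ evalPR p xs
  erase-correct Z         xs       = refl
  erase-correct S         (x ∷ []) = refl
  erase-correct (P i)     xs       = nth-toList xs i
  erase-correct (C f gs)  xs       =
    trans (cong (evalU (erase f)) (erase*-correct gs xs)) (erase-correct f (evalPRs gs xs))
  erase-correct (Rec g h) (k ∷ xs) = recursion k
    where
    recursion : ∀ k → evalRec (erase g) (erase h) k (toList xs) ≡ evalPR (Rec g h) (k ∷ xs)
    recursion zero    = erase-correct g xs
    recursion (suc k) = trans (cong (λ v → evalU (erase h) (k ∷ v ∷ toList xs)) (recursion k))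
                              (erase-correct h (k ∷ evalPR (Rec g h) (k ∷ xs) ∷ xs))

  erase*-correct : ∀ {m n} (gs : Vec (PR n) m) xs → evalU* (erase* gs) (toList xs) ≡ toList (evalPRs gs xs)
  erase*-correct []       xs = refl
  erase*-correct (g ∷ gs) xs = cong₂ _∷_ (erase-correct g xs) (erase*-correct gs xs)

-- Codes 0 and 1 are uZ and uS; above them the first component of the pair is a tag:
-- 0 for uP, 1 for uC, and 2 + (code of g) for uRec g h.

mutual
  ⌜_⌝ : UPR → ℕ
  ⌜ uZ ⌝       = 0
  ⌜ uS ⌝       = 1
  ⌜ uP i ⌝     = suc (suc (pair 0 i))
  ⌜ uC f gs ⌝  = suc (suc (pair 1 (pair ⌜ f ⌝ ⌜ gs ⌝*)))
  ⌜ uRec g h ⌝ = suc (suc (pair (suc (suc ⌜ g ⌝)) ⌜ h ⌝))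

  ⌜_⌝* : List UPR → ℕ
  ⌜ [] ⌝*     = 0
  ⌜ u ∷ us ⌝* = consN ⌜ u ⌝ ⌜ us ⌝*

-- Decoding by recursion on a fuel argument, which only has to exceed the code.
mutual
  decodeWith : ℕ → ℕ → UPR
  decodeWith zero    c               = uZ
  decodeWith (suc f) zero            = uZ
  decodeWith (suc f) (suc zero)      = uS
  decodeWith (suc f) (suc (suc q))   = decodeTagged f (π₁ q) (π₂ q)

  decodeTagged : ℕ → ℕ → ℕ → UPR
  decodeTagged f zero          b = uP b
  decodeTagged f (suc zero)    b = uC (decodeWith f (π₁ b)) (decodeWith* f (π₂ b))
  decodeTagged f (suc (suc a)) b = uRec (decodeWith f a) (decodeWith f b)

  decodeWith* : ℕ → ℕ → List UPR
  decodeWith* zero    c       = []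
  decodeWith* (suc f) zero    = []
  decodeWith* (suc f) (suc q) = decodeWith f (π₁ q) ∷ decodeWith* f (π₂ q)

decode : ℕ → UPR
decode c = decodeWith (suc c) c

private
  pair<ˡ : ∀ {a b f} → pair a b < f → a < f
  pair<ˡ {a} {b} = ≤-<-trans (≤-pairˡ a b)

  pair<ʳ : ∀ {a b f} → pair a b < f → b < f
  pair<ʳ {a} {b} = ≤-<-trans (≤-pairʳ a b)

  2+<⇒< : ∀ {x f} → suc (suc x) < suc f → x < f
  2+<⇒< (s≤s 2+x≤f) = <⇒≤ 2+x≤f

mutual
  decodeWith-⌜⌝ : ∀ f u → ⌜ u ⌝ < f → decodeWith f ⌜ u ⌝ ≡ u
  decodeWith-⌜⌝ (suc f) uZ         _ = refl
  decodeWith-⌜⌝ (suc f) uS         _ = refl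
  decodeWith-⌜⌝ (suc f) (uP i)     _ rewrite π₁-pair 0 i | π₂-pair 0 i = refl
  decodeWith-⌜⌝ (suc f) (uC g gs)  lt
    rewrite π₁-pair 1 (pair ⌜ g ⌝ ⌜ gs ⌝*) | π₂-pair 1 (pair ⌜ g ⌝ ⌜ gs ⌝*)
          | π₁-pair ⌜ g ⌝ ⌜ gs ⌝* | π₂-pair ⌜ g ⌝ ⌜ gs ⌝* =
    cong₂ uC (decodeWith-⌜⌝ f g (pair<ˡ args<f)) (decodeWith*-⌜⌝ f gs (pair<ʳ args<f))
    where
    args<f : pair ⌜ g ⌝ ⌜ gs ⌝* < f
    args<f = pair<ʳ (2+<⇒< lt)
  decodeWith-⌜⌝ (suc f) (uRec g h) lt
    rewrite π₁-pair (suc (suc ⌜ g ⌝)) ⌜ h ⌝ | π₂-pair (suc (suc ⌜ g ⌝)) ⌜ h ⌝ =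
    cong₂ uRec (decodeWith-⌜⌝ f g (≤-<-trans (m≤n+m ⌜ g ⌝ 2) (pair<ˡ (2+<⇒< lt))))
               (decodeWith-⌜⌝ f h (pair<ʳ (2+<⇒< lt)))

  decodeWith*-⌜⌝ : ∀ f us → ⌜ us ⌝* < f → decodeWith* f ⌜ us ⌝* ≡ us
  decodeWith*-⌜⌝ (suc f) []       _  = refl
  decodeWith*-⌜⌝ (suc f) (u ∷ us) (s≤s lt)
    rewrite π₁-pair ⌜ u ⌝ ⌜ us ⌝* | π₂-pair ⌜ u ⌝ ⌜ us ⌝* =
    cong₂ _∷_ (decodeWith-⌜⌝ f u (pair<ˡ lt)) (decodeWith*-⌜⌝ f us (pair<ʳ lt))

decode-⌜⌝ : ∀ u → decode ⌜ u ⌝ ≡ u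
decode-⌜⌝ u = decodeWith-⌜⌝ (suc ⌜ u ⌝) u ≤-refl

mutual
  ⌜decodeWith⌝ : ∀ f c → c < f → ⌜ decodeWith f c ⌝ ≡ c
  ⌜decodeWith⌝ (suc f) zero          _  = refl
  ⌜decodeWith⌝ (suc f) (suc zero)    _  = refl
  ⌜decodeWith⌝ (suc f) (suc (suc q)) lt = trans
    (⌜decodeTagged⌝ f (π₁ q) (π₂ q) (≤-<-trans (π₁≤ q) q<f) (≤-<-trans (π₂≤ q) q<f))
    (cong (λ p → suc (suc p)) (pair-π q))
    where
    q<f : q < f
    q<f = 2+<⇒< lt

  ⌜decodeTagged⌝ : ∀ f a b → a < f → b < f → ⌜ decodeTagged f a b ⌝ ≡ suc (suc (pair a b))
  ⌜decodeTagged⌝ f zero          b _  _  = refl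
  ⌜decodeTagged⌝ f (suc zero)    b _  b<f = cong (λ p → suc (suc (pair 1 p))) (trans
    (cong₂ pair (⌜decodeWith⌝ f (π₁ b) (≤-<-trans (π₁≤ b) b<f))
                (⌜decodeWith*⌝ f (π₂ b) (≤-<-trans (π₂≤ b) b<f)))
    (pair-π b))
  ⌜decodeTagged⌝ f (suc (suc a)) b a<f b<f =
    cong₂ (λ u v → suc (suc (pair (suc (suc u)) v)))
          (⌜decodeWith⌝ f a (≤-<-trans (m≤n+m a 2) a<f))
          (⌜decodeWith⌝ f b b<f)

  ⌜decodeWith*⌝ : ∀ f c → c < f → ⌜ decodeWith* f c ⌝* ≡ c
  ⌜decodeWith*⌝ (suc f) zero    _        = refl
  ⌜decodeWith*⌝ (suc f) (suc q) (s≤s lt) = cong suc (trans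
    (cong₂ pair (⌜decodeWith⌝ f (π₁ q) (≤-<-trans (π₁≤ q) lt))
                (⌜decodeWith*⌝ f (π₂ q) (≤-<-trans (π₂≤ q) lt)))
    (pair-π q))

⌜decode⌝ : ∀ c → ⌜ decode c ⌝ ≡ c
⌜decode⌝ c = ⌜decodeWith⌝ (suc c) c ≤-refl

-- A stack machine evaluating codes

-- eval u l pushes the value of u on the list coded by l and evalAll gs l the coded list of
-- the values of gs; consTop conses the top two values; apply f runs f on the list on top;
-- recStep h l, where l codes k ∷ xs, replaces the top value v by the value of h on k ∷ v ∷ xs.
data Task : Set where
  eval    : UPR → ℕ → Task
  evalAll : List UPR → ℕ → Task
  consTop : Task
  apply   : UPR → Task
  recStep : UPR → ℕ → Task

Config : Set
Config = List Task × List ℕ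

step : Config → Config
step ([] , vs) = [] , vs
step (eval uZ l ∷ ts , vs)     = ts , 0 ∷ vs
step (eval uS l ∷ ts , vs)     = ts , suc (headN l) ∷ vs
step (eval (uP i) l ∷ ts , vs) = ts , nthN i l ∷ vs
step (eval (uC f gs) l ∷ ts , vs) = evalAll gs l ∷ apply f ∷ ts , vs
step (eval (uRec g h) l ∷ ts , vs) =
  ifz (headN l) (eval g (tailN l) ∷ ts , vs)
                (eval (uRec g h) l′ ∷ recStep h l′ ∷ ts , vs)
  where
  l′ : ℕ
  l′ = consN (pred (headN l)) (tailN l)
step (evalAll [] l ∷ ts , vs)       = ts , 0 ∷ vs
step (evalAll (g ∷ gs) l ∷ ts , vs) = eval g l ∷ evalAll gs l ∷ consTop ∷ ts , vs
step (consTop ∷ ts , vs)   = ts , consN (hd (tl vs)) (hd vs) ∷ tl (tl vs)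
step (apply f ∷ ts , vs)   = eval f (hd vs) ∷ ts , tl vs
step (recStep h l ∷ ts , vs) = eval h (consN (headN l) (consN (hd vs) (tailN l))) ∷ ts , tl vs

_⟶_ : Config → Config → Set
c ⟶ d = step c ≡ d

Reaches : Config → Config → Set
Reaches = Star _⟶_

step-uRec-zero : ∀ g h l ts vs → step (eval (uRec g h) (consN 0 l) ∷ ts , vs) ≡ (eval g l ∷ ts , vs)
step-uRec-zero g h l ts vs rewrite headN-consN 0 l | tailN-consN 0 l = refl

step-uRec-suc : ∀ g h k l ts vs →
  step (eval (uRec g h) (consN (suc k) l) ∷ ts , vs) ≡
  (eval (uRec g h) (consN k l) ∷ recStep h (consN k l) ∷ ts , vs)
step-uRec-suc g h k l ts vs rewrite headN-consN (suc k) l | tailN-consN (suc k) l = refl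

step-recStep : ∀ h k l v ts vs →
  step (recStep h (consN k l) ∷ ts , v ∷ vs) ≡ (eval h (consN k (consN v l)) ∷ ts , vs)
step-recStep h k l v ts vs rewrite headN-consN k l | tailN-consN k l = refl

mutual
  eval-reaches : ∀ u a ts vs → Reaches (eval u (encodeList a) ∷ ts , vs) (ts , evalU u a ∷ vs)
  eval-reaches uZ         a ts vs = refl ◅ ε
  eval-reaches uS         a ts vs = cong (λ x → ts , suc x ∷ vs) (headN-encode a) ◅ ε
  eval-reaches (uP i)     a ts vs = cong (λ x → ts , x ∷ vs) (nthN-encode i a) ◅ ε
  eval-reaches (uC f gs)  a ts vs =
    refl ◅ (evalAll-reaches gs a (apply f ∷ ts) vs ◅◅ (refl ◅ eval-reaches f (evalU* gs a) ts vs))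
  eval-reaches (uRec g h) []      ts vs = refl ◅ eval-reaches g [] ts vs
  eval-reaches (uRec g h) (k ∷ a) ts vs = evalRec-reaches g h k a ts vs

  evalAll-reaches : ∀ gs a ts vs →
    Reaches (evalAll gs (encodeList a) ∷ ts , vs) (ts , encodeList (evalU* gs a) ∷ vs)
  evalAll-reaches []       a ts vs = refl ◅ ε
  evalAll-reaches (g ∷ gs) a ts vs =
    refl ◅ (eval-reaches g a _ vs ◅◅ (evalAll-reaches gs a _ _ ◅◅ (refl ◅ ε)))

  evalRec-reaches : ∀ g h k a ts vs →
    Reaches (eval (uRec g h) (encodeList (k ∷ a)) ∷ ts , vs) (ts , evalRec g h k a ∷ vs)
  evalRec-reaches g h zero    a ts vs =
    step-uRec-zero g h (encodeList a) ts vs ◅ eval-reaches g a ts vs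
  evalRec-reaches g h (suc k) a ts vs =
    step-uRec-suc g h k (encodeList a) ts vs ◅
    (evalRec-reaches g h k a (recStep h (encodeList (k ∷ a)) ∷ ts) vs ◅◅
     (step-recStep h k (encodeList a) (evalRec g h k a) ts vs ◅
      eval-reaches h (k ∷ evalRec g h k a ∷ a) ts vs))

encodeTask : Task → ℕ
encodeTask (eval u l)     = pair 0 (pair ⌜ u ⌝ l)
encodeTask (evalAll gs l) = pair 1 (pair ⌜ gs ⌝* l)
encodeTask consTop        = pair 2 0
encodeTask (apply f)      = pair 3 ⌜ f ⌝
encodeTask (recStep h l)  = pair 4 (pair ⌜ h ⌝ l)

encodeTasks : List Task → ℕ
encodeTasks []       = 0
encodeTasks (t ∷ ts) = consN (encodeTask t) (encodeTasks ts)

encodeConfig : Config → ℕ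
encodeConfig (ts , vs) = pair (encodeTasks ts) (encodeList vs)

consE : ∀ {n} → Expr n → Expr n → Expr n
consE a b = `suc (`pair a b)

headE tailE : ∀ {n} → Expr n → Expr n
headE x = `ifz x (lit 0) (`π₁ (`pred x))
tailE x = `ifz x (lit 0) (`π₂ (`pred x))

recE : Expr 5
recE = `ifz (headE l)
         (`pair (consE (`pair (lit 0) (`pair g (tailE l))) rest) vals)
         (`pair (consE (`pair (lit 0) (`pair ⌜uRec⌝ l′)) (consE (`pair (lit 4) (`pair h l′)) rest)) vals)
  where
  g h l rest vals ⌜uRec⌝ l′ : Expr 5
  g = var (# 0); h = var (# 1); l = var (# 2); rest = var (# 3); vals = var (# 4)
  ⌜uRec⌝ = `suc (`suc (`pair (`suc (`suc g)) h))
  l′ = consE (`pred (headE l)) (tailE l)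

evalTaggedE : Expr 5
evalTaggedE =
  `ifz a (`pair rest (consE (headE (`iter b l (tailE (var (# 0))))) vals))
  (`ifz (`pred a) (`pair (consE (`pair (lit 1) (`pair (`π₂ b) l)) (consE (`pair (lit 3) (`π₁ b)) rest)) vals)
                  (call recE (`pred (`pred a) ∷ b ∷ l ∷ rest ∷ vals ∷ [])))
  where
  a b l rest vals : Expr 5
  a = var (# 0); b = var (# 1); l = var (# 2); rest = var (# 3); vals = var (# 4)

evalE : Expr 4
evalE =
  `ifz u (`pair rest (consE (lit 0) vals))
  (`ifz (`pred u) (`pair rest (consE (`suc (headE l)) vals))
                  (call evalTaggedE (`π₁ c ∷ `π₂ c ∷ l ∷ rest ∷ vals ∷ [])))
  where
  u l rest vals c : Expr 4
  u = var (# 0); l = var (# 1); rest = var (# 2); vals = var (# 3)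
  c = `pred (`pred u)

evalAllE : Expr 4
evalAllE =
  `ifz gs (`pair rest (consE (lit 0) vals))
          (`pair (consE (`pair (lit 0) (`pair (`π₁ (`pred gs)) l))
                 (consE (`pair (lit 1) (`pair (`π₂ (`pred gs)) l))
                 (consE (`pair (lit 2) (lit 0)) rest))) vals)
  where
  gs l rest vals : Expr 4
  gs = var (# 0); l = var (# 1); rest = var (# 2); vals = var (# 3)

consTopE : Expr 2
consTopE = `pair rest (consE (consE (headE (tailE vals)) (headE vals)) (tailE (tailE vals)))
  where
  rest vals : Expr 2
  rest = var (# 0); vals = var (# 1)

applyE : Expr 3
applyE = `pair (consE (`pair (lit 0) (`pair f (headE vals))) rest) (tailE vals)
  where
  f rest vals : Expr 3
  f = var (# 0); rest = var (# 1); vals = var (# 2)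

recStepE : Expr 4
recStepE =
  `pair (consE (`pair (lit 0) (`pair h (consE (headE l) (consE (headE vals) (tailE l))))) rest)
        (tailE vals)
  where
  h l rest vals : Expr 4
  h = var (# 0); l = var (# 1); rest = var (# 2); vals = var (# 3)

dispatchE : Expr 4
dispatchE =
  `ifz tag (call evalE (`π₁ payload ∷ `π₂ payload ∷ rest ∷ vals ∷ []))
  (`ifz (`pred tag) (call evalAllE (`π₁ payload ∷ `π₂ payload ∷ rest ∷ vals ∷ []))
  (`ifz (`pred (`pred tag)) (call consTopE (rest ∷ vals ∷ []))
  (`ifz (`pred (`pred (`pred tag))) (call applyE (payload ∷ rest ∷ vals ∷ []))
        (call recStepE (`π₁ payload ∷ `π₂ payload ∷ rest ∷ vals ∷ [])))))
  where
  tag payload rest vals : Expr 4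
  tag = var (# 0); payload = var (# 1); rest = var (# 2); vals = var (# 3)

popE : Expr 3
popE = call dispatchE (`π₁ task ∷ `π₂ task ∷ rest ∷ vals ∷ [])
  where
  task rest vals : Expr 3
  task = var (# 0); rest = var (# 1); vals = var (# 2)

stepConfigE : Expr 2
stepConfigE = `ifz tasks (`pair tasks vals) (call popE (`π₁ (`pred tasks) ∷ `π₂ (`pred tasks) ∷ vals ∷ []))
  where
  tasks vals : Expr 2
  tasks = var (# 0); vals = var (# 1)

stepE : Expr 1
stepE = call stepConfigE (`π₁ (var (# 0)) ∷ `π₂ (var (# 0)) ∷ [])

stepN : ℕ → ℕ
stepN x = ⟦ stepE ⟧ (x ∷ [])

⟦⟧-unpair : ∀ {n} (e : Expr (2 + n)) a b xs →
            ⟦ e ⟧ (π₁ (pair a b) ∷ π₂ (pair a b) ∷ xs) ≡ ⟦ e ⟧ (a ∷ b ∷ xs)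
⟦⟧-unpair e a b xs = cong₂ (λ x y → ⟦ e ⟧ (x ∷ y ∷ xs)) (π₁-pair a b) (π₂-pair a b)

stepN-pop : ∀ tag payload ts vs →
  stepN (pair (consN (pair tag payload) ts) vs) ≡ ⟦ dispatchE ⟧ (tag ∷ payload ∷ ts ∷ vs ∷ [])
stepN-pop tag payload ts vs = begin
  stepN (pair tasks vs)
    ≡⟨ ⟦⟧-unpair stepConfigE tasks vs [] ⟩
  ⟦ popE ⟧ (π₁ (pair task ts) ∷ π₂ (pair task ts) ∷ vs ∷ [])
    ≡⟨ ⟦⟧-unpair popE task ts (vs ∷ []) ⟩
  ⟦ dispatchE ⟧ (π₁ task ∷ π₂ task ∷ ts ∷ vs ∷ [])
    ≡⟨ ⟦⟧-unpair dispatchE tag payload (ts ∷ vs ∷ []) ⟩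
  ⟦ dispatchE ⟧ (tag ∷ payload ∷ ts ∷ vs ∷ [])
    ∎
  where
  open ≡-Reasoning
  task tasks : ℕ
  task  = pair tag payload
  tasks = consN task ts

evalE-correct : ∀ u l ts vs →
  ⟦ evalE ⟧ (⌜ u ⌝ ∷ l ∷ encodeTasks ts ∷ encodeList vs ∷ []) ≡ encodeConfig (step (eval u l ∷ ts , vs))
evalE-correct uZ         l ts vs = refl
evalE-correct uS         l ts vs = refl
evalE-correct (uP i)     l ts vs = ⟦⟧-unpair evalTaggedE 0 i (l ∷ encodeTasks ts ∷ encodeList vs ∷ [])
evalE-correct (uC f gs)  l ts vs = begin
  ⟦ evalTaggedE ⟧ (π₁ (pair 1 fgs) ∷ π₂ (pair 1 fgs) ∷ l ∷ TS ∷ VS ∷ [])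
    ≡⟨ ⟦⟧-unpair evalTaggedE 1 fgs (l ∷ TS ∷ VS ∷ []) ⟩
  pair (consN (pair 1 (pair (π₂ fgs) l)) (consN (pair 3 (π₁ fgs)) TS)) VS
    ≡⟨ cong₂ (λ x y → pair (consN (pair 1 (pair y l)) (consN (pair 3 x) TS)) VS)
             (π₁-pair ⌜ f ⌝ ⌜ gs ⌝*) (π₂-pair ⌜ f ⌝ ⌜ gs ⌝*) ⟩
  encodeConfig (evalAll gs l ∷ apply f ∷ ts , vs) ∎
  where
  open ≡-Reasoning
  fgs TS VS : ℕ
  fgs = pair ⌜ f ⌝ ⌜ gs ⌝*
  TS = encodeTasks ts
  VS = encodeList vs
evalE-correct (uRec g h) l ts vs = begin
  ⟦ evalTaggedE ⟧ (π₁ (pair (2 + ⌜ g ⌝) ⌜ h ⌝) ∷ π₂ (pair (2 + ⌜ g ⌝) ⌜ h ⌝) ∷ l ∷ TS ∷ VS ∷ [])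
    ≡⟨ ⟦⟧-unpair evalTaggedE (2 + ⌜ g ⌝) ⌜ h ⌝ (l ∷ TS ∷ VS ∷ []) ⟩
  ifz (headN l) (encodeConfig base) (encodeConfig recurse)
    ≡⟨ ifz-distrib encodeConfig (headN l) base recurse ⟨
  encodeConfig (step (eval (uRec g h) l ∷ ts , vs)) ∎
  where
  open ≡-Reasoning
  TS VS l′ : ℕ
  TS = encodeTasks ts
  VS = encodeList vs
  l′ = consN (pred (headN l)) (tailN l)
  base recurse : Config
  base    = eval g (tailN l) ∷ ts , vs
  recurse = eval (uRec g h) l′ ∷ recStep h l′ ∷ ts , vs

evalAllE-correct : ∀ gs l ts vs →
  ⟦ evalAllE ⟧ (⌜ gs ⌝* ∷ l ∷ encodeTasks ts ∷ encodeList vs ∷ []) ≡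
  encodeConfig (step (evalAll gs l ∷ ts , vs))
evalAllE-correct []       l ts vs = refl
evalAllE-correct (g ∷ gs) l ts vs =
  cong₂ (λ x y → pair (consN (pair 0 (pair x l)) (consN (pair 1 (pair y l)) (consN (pair 2 0) TS))) VS)
        (π₁-pair ⌜ g ⌝ ⌜ gs ⌝*) (π₂-pair ⌜ g ⌝ ⌜ gs ⌝*)
  where
  TS VS : ℕ
  TS = encodeTasks ts
  VS = encodeList vs

step-commutes : ∀ c → stepN (encodeConfig c) ≡ encodeConfig (step c)
step-commutes ([] , vs) = ⟦⟧-unpair stepConfigE 0 (encodeList vs) []
step-commutes (eval u l ∷ ts , vs) = begin
  stepN (encodeConfig (eval u l ∷ ts , vs))
    ≡⟨ stepN-pop 0 (pair ⌜ u ⌝ l) TS VS ⟩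
  ⟦ evalE ⟧ (π₁ (pair ⌜ u ⌝ l) ∷ π₂ (pair ⌜ u ⌝ l) ∷ TS ∷ VS ∷ [])
    ≡⟨ ⟦⟧-unpair evalE ⌜ u ⌝ l (TS ∷ VS ∷ []) ⟩
  ⟦ evalE ⟧ (⌜ u ⌝ ∷ l ∷ TS ∷ VS ∷ [])
    ≡⟨ evalE-correct u l ts vs ⟩
  encodeConfig (step (eval u l ∷ ts , vs)) ∎
  where
  open ≡-Reasoning
  TS VS : ℕ
  TS = encodeTasks ts
  VS = encodeList vs
step-commutes (evalAll gs l ∷ ts , vs) = begin
  stepN (encodeConfig (evalAll gs l ∷ ts , vs))
    ≡⟨ stepN-pop 1 (pair ⌜ gs ⌝* l) TS VS ⟩
  ⟦ evalAllE ⟧ (π₁ (pair ⌜ gs ⌝* l) ∷ π₂ (pair ⌜ gs ⌝* l) ∷ TS ∷ VS ∷ [])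
    ≡⟨ ⟦⟧-unpair evalAllE ⌜ gs ⌝* l (TS ∷ VS ∷ []) ⟩
  ⟦ evalAllE ⟧ (⌜ gs ⌝* ∷ l ∷ TS ∷ VS ∷ [])
    ≡⟨ evalAllE-correct gs l ts vs ⟩
  encodeConfig (step (evalAll gs l ∷ ts , vs)) ∎
  where
  open ≡-Reasoning
  TS VS : ℕ
  TS = encodeTasks ts
  VS = encodeList vs
step-commutes (consTop ∷ ts , vs) = begin
  stepN (encodeConfig (consTop ∷ ts , vs))
    ≡⟨ stepN-pop 2 0 TS (encodeList vs) ⟩
  pair TS (consN (consN (headN (tailN (encodeList vs))) (headN (encodeList vs)))
                 (tailN (tailN (encodeList vs))))
    ≡⟨ cong₂ (λ x y → pair TS (consN (consN (headN x) y) (tailN x))) (tailN-encode vs) (headN-encode vs) ⟩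
  pair TS (consN (consN (headN (encodeList (tl vs))) (hd vs)) (tailN (encodeList (tl vs))))
    ≡⟨ cong₂ (λ x y → pair TS (consN (consN x (hd vs)) y)) (headN-encode (tl vs)) (tailN-encode (tl vs)) ⟩
  encodeConfig (step (consTop ∷ ts , vs)) ∎
  where
  open ≡-Reasoning
  TS : ℕ
  TS = encodeTasks ts
step-commutes (apply f ∷ ts , vs) =
  trans (stepN-pop 3 ⌜ f ⌝ TS (encodeList vs))
        (cong₂ (λ x y → pair (consN (pair 0 (pair ⌜ f ⌝ x)) TS) y) (headN-encode vs) (tailN-encode vs))
  where
  TS : ℕ
  TS = encodeTasks ts
step-commutes (recStep h l ∷ ts , vs) = begin
  stepN (encodeConfig (recStep h l ∷ ts , vs))
    ≡⟨ stepN-pop 4 (pair ⌜ h ⌝ l) TS VS ⟩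
  ⟦ recStepE ⟧ (π₁ (pair ⌜ h ⌝ l) ∷ π₂ (pair ⌜ h ⌝ l) ∷ TS ∷ VS ∷ [])
    ≡⟨ ⟦⟧-unpair recStepE ⌜ h ⌝ l (TS ∷ VS ∷ []) ⟩
  pair (consN (pair 0 (pair ⌜ h ⌝ (consN (headN l) (consN (headN VS) (tailN l))))) TS) (tailN VS)
    ≡⟨ cong₂ (λ x y → pair (consN (pair 0 (pair ⌜ h ⌝ (consN (headN l) (consN x (tailN l))))) TS) y)
             (headN-encode vs) (tailN-encode vs) ⟩
  encodeConfig (step (recStep h l ∷ ts , vs)) ∎
  where
  open ≡-Reasoning
  TS VS : ℕ
  TS = encodeTasks ts
  VS = encodeList vs

simulate : ∀ {c d} → Reaches c d → Σ ℕ λ n → iter stepN n (encodeConfig c) ≡ encodeConfig d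
simulate ε = 0 , refl
simulate {c} {d} (_◅_ {j = c′} c⟶c′ c′↠d) with simulate c′↠d
... | n , eq = suc n , (begin
  iter stepN (suc n) (encodeConfig c)      ≡⟨ iter-suc stepN n (encodeConfig c) ⟩
  iter stepN n (stepN (encodeConfig c))    ≡⟨ cong (iter stepN n) (step-commutes c) ⟩
  iter stepN n (encodeConfig (step c))     ≡⟨ cong (λ c″ → iter stepN n (encodeConfig c″)) c⟶c′ ⟩
  iter stepN n (encodeConfig c′)           ≡⟨ eq ⟩
  encodeConfig d                           ∎)
  where open ≡-Reasoning

-- A computable function that is not primitive recursive

selfApply : ℕ → ℕ
selfApply x = evalU (decode x) (x ∷ [])

diag : ℕ → ℕ
diag x = ifz (selfApply x) 1 0

diag-01 : ∀ n → diag n ≡ 0 ⊎ diag n ≡ 1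
diag-01 n with selfApply n
... | zero  = inj₂ refl
... | suc _ = inj₁ refl

diag-not-primRec : ¬ IsPrimRec diag
diag-not-primRec (q , q≡diag) =
  differs (evalPR q (c ∷ [])) (trans (q≡diag c) (cong (λ v → ifz v 1 0) selfApply-c))
  where
  c : ℕ
  c = ⌜ erase q ⌝
  selfApply-c : selfApply c ≡ evalPR q (c ∷ [])
  selfApply-c = trans (cong (λ u → evalU u (c ∷ [])) (decode-⌜⌝ (erase q))) (erase-correct q (c ∷ []))
  differs : ∀ t → ¬ t ≡ ifz t 1 0
  differs zero    ()
  differs (suc t) ()

initial : ℕ → ℕ
initial x = encodeConfig (eval (decode x) (encodeList (x ∷ [])) ∷ [] , [])

-- The code of the initial configuration, written without decode thanks to ⌜ decode x ⌝ ≡ x.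
initialE : Expr 1
initialE = `pair (consE (`pair (lit 0) (`pair x (consE x (lit 0)))) (lit 0)) (lit 0)
  where
  x : Expr 1
  x = var (# 0)

initialE-correct : ∀ x → ⟦ initialE ⟧ (x ∷ []) ≡ initial x
initialE-correct x = cong (λ c → pair (consN (pair 0 (pair c (consN x 0))) 0) 0) (sym (⌜decode⌝ x))

runN : ℕ → ℕ → ℕ
runN x s = iter stepN s (initial x)

runE : Expr 2
runE = `iter (var (# 0)) (call initialE (var (# 1) ∷ [])) (call stepE (var (# 0) ∷ []))

runE-correct : ∀ s x → ⟦ runE ⟧ (s ∷ x ∷ []) ≡ runN x s
runE-correct s x = cong (iter stepN s) (initialE-correct x)

machine-halts : ∀ x → Σ ℕ λ n → runN x n ≡ pair 0 (consN (selfApply x) 0)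
machine-halts x = simulate (eval-reaches (decode x) (x ∷ []) [] [])

stepN-halted : ∀ y → π₁ y ≡ 0 → stepN y ≡ y
stepN-halted y halted = begin
  ⟦ stepConfigE ⟧ (π₁ y ∷ π₂ y ∷ []) ≡⟨ cong (λ t → ⟦ stepConfigE ⟧ (t ∷ π₂ y ∷ [])) halted ⟩
  pair 0 (π₂ y)                      ≡⟨ cong (λ t → pair t (π₂ y)) halted ⟨
  pair (π₁ y) (π₂ y)                 ≡⟨ pair-π y ⟩
  y                                  ∎
  where open ≡-Reasoning

runN-halted : ∀ x {s n} → π₁ (runN x s) ≡ 0 → s ≤ n → runN x n ≡ runN x s
runN-halted x {s} {n} halted s≤n = begin
  iter stepN n (initial x)           ≡⟨ cong (λ k → iter stepN k (initial x)) (m∸n+n≡m s≤n) ⟨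
  iter stepN (n ∸ s + s) (initial x) ≡⟨ iter-+ stepN (n ∸ s) s (initial x) ⟩
  iter stepN (n ∸ s) (runN x s)      ≡⟨ iter-fixed stepN (runN x s) (stepN-halted (runN x s) halted) (n ∸ s) ⟩
  runN x s                           ∎
  where open ≡-Reasoning

FirstHalt : ℕ → ℕ → Set
FirstHalt x s = (∀ k → k < s → π₁ (runN x k) ≢ 0) × runN x s ≡ pair 0 (consN (selfApply x) 0)

first-halt : ∀ x → Σ ℕ (FirstHalt x)
first-halt x with machine-halts x
... | n , halts with least-witness (λ s → π₁ (runN x s) ≡ 0) (λ s → π₁ (runN x s) ≟ 0) n
                           (trans (cong π₁ halts) (π₁-pair 0 _))
... | s , halted , s≤n , running = s , running , trans (sym (runN-halted x halted s≤n)) halts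

haltedE outputE : Expr 2
haltedE = `ifz (`π₁ runE) (lit 0) (lit 1)
outputE = `ifz (headE (`π₂ runE)) (lit 1) (lit 0)

-- μ-search for the first step s at which the task stack is empty, then read off the result.
diagProgram : PRec 1
diagProgram = C (compute outputE) (Mu (compute haltedE) ∷ P zero ∷ [])

diag-computable : IsComputable diag
diag-computable = diagProgram , correct
  where
  haltedE-correct : ∀ k x → ⟦ haltedE ⟧ (k ∷ x ∷ []) ≡ ifz (π₁ (runN x k)) 0 1
  haltedE-correct k x = cong (λ y → ifz (π₁ y) 0 1) (runE-correct k x)

  correct : ∀ x → diagProgram [ x ∷ [] ]⇓ diag x
  correct x with first-halt x
  ... | s , running , final = ⇓C (⇓Mu stops waits ∷ ⇓P ∷ []) outputs
    where
    stops : compute haltedE [ s ∷ x ∷ [] ]⇓ 0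
    stops = compute-correct haltedE (s ∷ x ∷ [])
      (trans (haltedE-correct s x) (cong (λ t → ifz t 0 1) (trans (cong π₁ final) (π₁-pair 0 _))))
    waits : ∀ k → k < s → Σ ℕ λ j → compute haltedE [ k ∷ x ∷ [] ]⇓ suc j
    waits k k<s = 0 , compute-correct haltedE (k ∷ x ∷ [])
      (trans (haltedE-correct k x) (ifz-nonzero (π₁ (runN x k)) (running k k<s)))
    outputs : compute outputE [ s ∷ x ∷ [] ]⇓ diag x
    outputs = compute-correct outputE (s ∷ x ∷ []) (begin
      ifz (headN (π₂ (⟦ runE ⟧ (s ∷ x ∷ [])))) 1 0
        ≡⟨ cong (λ y → ifz (headN (π₂ y)) 1 0) (trans (runE-correct s x) final) ⟩
      ifz (headN (π₂ (pair 0 (consN (selfApply x) 0)))) 1 0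
        ≡⟨ cong (λ y → ifz (headN y) 1 0) (π₂-pair 0 _) ⟩
      ifz (headN (consN (selfApply x) 0)) 1 0
        ≡⟨ cong (λ v → ifz v 1 0) (headN-consN (selfApply x) 0) ⟩
      diag x ∎)
      where open ≡-Reasoning

-- Spine trees

oracleApply : ∀ {d : ℕ → ℕ} → IsComputable d → (e : Expr 2) (i : Expr 1) →
              IsComputable (λ x → ⟦ e ⟧ (d (⟦ i ⟧ (x ∷ [])) ∷ x ∷ []))
oracleApply (dProgram , dProgram-correct) e i =
  C (compute e) (C dProgram (compute i ∷ []) ∷ P zero ∷ []) ,
  λ x → ⇓C (⇓C (compute-correct i (x ∷ []) refl ∷ []) (dProgram-correct _) ∷ ⇓P ∷ [])
            (compute-correct e _ refl)

differ : ℕ → ℕ → ℕ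
differ a b = ifz (a ∸ b) (ifz (b ∸ a) 0 1) 1

differ-refl : ∀ a → differ a a ≡ 0
differ-refl a rewrite n∸n≡0 a = refl

differ-≢ : ∀ {a b} → a ≢ b → differ a b ≡ 1
differ-≢ {a} {b} a≢b with a ∸ b in a∸b | b ∸ a in b∸a
... | zero  | zero  = contradiction (≤-antisym (m∸n≡0⇒m≤n a∸b) (m∸n≡0⇒m≤n b∸a)) a≢b
... | zero  | suc _ = refl
... | suc _ | _     = refl

module SpineTree (d : ℕ → ℕ) (d-01 : ∀ n → d n ≡ 0 ⊎ d n ≡ 1) where

  spine leaf : ℕ → ℕ
  spine n = suc (pair n 0)
  leaf  n = suc (pair n 1)

  spine-injective : ∀ {m n} → spine m ≡ spine n → m ≡ n
  spine-injective eq = proj₁ (pair-injective (suc-injective eq))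

  leaf-injective : ∀ {m n} → leaf m ≡ leaf n → m ≡ n
  leaf-injective eq = proj₁ (pair-injective (suc-injective eq))

  spine≢leaf : ∀ {m n} → spine m ≢ leaf n
  spine≢leaf eq with proj₂ (pair-injective (suc-injective eq))
  ... | ()

  private
    dₙ node : Expr 2
    dₙ   = var (# 0)
    node = var (# 1)

  -- Codes not of the form 0, spine n or leaf n are sent to 0.
  succ¹E succ²E memberE : Expr 2
  succ¹E = `ifz node (lit 0)
             (`ifz (`π₂ (`pred node)) (`suc (`pair (`suc (`π₁ (`pred node))) (lit 0))) (lit 0))
  succ²E = `ifz node (lit 0)
             (`ifz (`π₂ (`pred node)) (`ifz dₙ (lit 0) (`suc (`pair (`π₁ (`pred node)) (lit 1)))) (lit 0))
  memberE = `ifz node (lit 1)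
              (`ifz (`π₂ (`pred node)) (lit 1) (`ifz (`pred (`π₂ (`pred node))) dₙ (lit 0)))

  index : Expr 1
  index = `π₁ (`pred (var (# 0)))

  withOracle : Expr 2 → ℕ → ℕ
  withOracle e x = ⟦ e ⟧ (d (⟦ index ⟧ (x ∷ [])) ∷ x ∷ [])

  succ¹ succ² member : ℕ → ℕ
  succ¹  = withOracle succ¹E
  succ²  = withOracle succ²E
  member = withOracle memberE

  succ¹-spine : ∀ n → succ¹ (spine n) ≡ spine (suc n)
  succ¹-spine n rewrite π₁-pair n 0 | π₂-pair n 0 = refl

  succ¹-leaf : ∀ n → succ¹ (leaf n) ≡ 0
  succ¹-leaf n rewrite π₂-pair n 1 = refl

  succ²-spine : ∀ n → succ² (spine n) ≡ ifz (d n) 0 (leaf n)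
  succ²-spine n rewrite π₁-pair n 0 | π₂-pair n 0 = refl

  succ²-leaf : ∀ n → succ² (leaf n) ≡ 0
  succ²-leaf n rewrite π₂-pair n 1 = refl

  member-spine : ∀ n → member (spine n) ≡ 1
  member-spine n rewrite π₂-pair n 0 = refl

  member-leaf : ∀ n → member (leaf n) ≡ d n
  member-leaf n rewrite π₁-pair n 1 | π₂-pair n 1 = refl

  succ²-spine-cases : ∀ n → (succ² (spine n) ≡ 0 × d n ≡ 0) ⊎ (succ² (spine n) ≡ leaf n × d n ≡ 1)
  succ²-spine-cases n with d-01 n
  ... | inj₁ dn≡0 = inj₁ (trans (succ²-spine n) (cong (λ v → ifz v 0 (leaf n)) dn≡0) , dn≡0)
  ... | inj₂ dn≡1 = inj₂ (trans (succ²-spine n) (cong (λ v → ifz v 0 (leaf n)) dn≡1) , dn≡1)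

  data Node : ℕ → Set where
    empty  : Node 0
    spine∈ : ∀ n → Node (spine n)
    leaf∈  : ∀ n → d n ≡ 1 → Node (leaf n)

  succ¹∈ : ∀ x → Node x → Node (succ¹ x)
  succ¹∈ _ empty        = empty
  succ¹∈ _ (spine∈ n)   = subst Node (sym (succ¹-spine n)) (spine∈ (suc n))
  succ¹∈ _ (leaf∈ n _)  = subst Node (sym (succ¹-leaf n)) empty

  succ²∈ : ∀ x → Node x → Node (succ² x)
  succ²∈ _ empty       = empty
  succ²∈ _ (spine∈ n) with succ²-spine-cases n
  ... | inj₁ (s≡0 , _)       = subst Node (sym s≡0) empty
  ... | inj₂ (s≡leaf , dn≡1) = subst Node (sym s≡leaf) (leaf∈ n dn≡1)
  succ²∈ _ (leaf∈ n _) = subst Node (sym (succ²-leaf n)) empty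

  Tree : Str
  Tree = record
    { Dom = Node ; S¹ = succ¹ ; S² = succ² ; e = 0 ; r = spine 0
    ; e∈ = empty ; r∈ = spine∈ 0 ; S¹∈ = succ¹∈ ; S²∈ = succ²∈ }

  private
    iter-absorbed : ∀ (f : ℕ → ℕ) → f 0 ≡ 0 → ∀ n {x} → f x ≡ 0 → iter f (suc n) x ≡ 0
    iter-absorbed f f0≡0 n {x} fx≡0 =
      trans (iter-suc f n x) (trans (cong (iter f n) fx≡0) (iter-fixed f 0 f0≡0 n))

    iter-succ¹-spine : ∀ k m → iter succ¹ k (spine m) ≡ spine (k + m)
    iter-succ¹-spine zero    m = refl
    iter-succ¹-spine (suc k) m = trans (cong succ¹ (iter-succ¹-spine k m)) (succ¹-spine (k + m))

    iter-succ²-spine : ∀ k m → iter succ² (suc k) (spine m) ≡ 0 ⊎ iter succ² (suc k) (spine m) ≡ leaf m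
    iter-succ²-spine k m with succ²-spine-cases m
    ... | inj₁ (s≡0 , _)    = inj₁ (iter-absorbed succ² refl k s≡0)
    ... | inj₂ (s≡leaf , _) with k
    ...   | zero   = inj₂ s≡leaf
    ...   | suc k′ = inj₁ (begin
      iter succ² (2 + k′) (spine m)         ≡⟨ iter-suc succ² (suc k′) (spine m) ⟩
      iter succ² (suc k′) (succ² (spine m)) ≡⟨ cong (iter succ² (suc k′)) s≡leaf ⟩
      iter succ² (suc k′) (leaf m)          ≡⟨ iter-absorbed succ² refl k′ (succ²-leaf m) ⟩
      0                                     ∎)
      where open ≡-Reasoning

  succ¹-nonzero : ∀ {x} → Node x → succ¹ x ≢ 0 → Σ ℕ λ n → x ≡ spine n
  succ¹-nonzero empty       s≢0 = contradiction refl s≢0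
  succ¹-nonzero (spine∈ n)  s≢0 = n , refl
  succ¹-nonzero (leaf∈ n _) s≢0 = contradiction (succ¹-leaf n) s≢0

  succ²-nonzero : ∀ {x} → Node x → succ² x ≢ 0 → Σ ℕ λ n → x ≡ spine n × succ² x ≡ leaf n
  succ²-nonzero empty       s≢0 = contradiction refl s≢0
  succ²-nonzero (spine∈ n)  s≢0 with succ²-spine-cases n
  ... | inj₁ (s≡0 , _)    = contradiction s≡0 s≢0
  ... | inj₂ (s≡leaf , _) = n , refl , s≡leaf
  succ²-nonzero (leaf∈ n _) s≢0 = contradiction (succ²-leaf n) s≢0

  succ¹-noCycles : NoCycles Tree succ¹
  succ¹-noCycles _ empty       x≢0 n _  = x≢0 refl
  succ¹-noCycles _ (spine∈ m)  _   n eq =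
    m≢1+n+m m (sym (spine-injective (trans (sym (iter-succ¹-spine (suc n) m)) eq)))
  succ¹-noCycles _ (leaf∈ m _) _   n eq with trans (sym (iter-absorbed succ¹ refl n (succ¹-leaf m))) eq
  ... | ()

  succ²-noCycles : NoCycles Tree succ²
  succ²-noCycles _ empty       x≢0 n _ = x≢0 refl
  succ²-noCycles _ (spine∈ m)  _   n eq with iter-succ²-spine n m
  ... | inj₁ it≡0 with trans (sym it≡0) eq
  ...   | ()
  succ²-noCycles _ (spine∈ m)  _   n eq | inj₂ it≡leaf = spine≢leaf (trans (sym eq) it≡leaf)
  succ²-noCycles _ (leaf∈ m _) _   n eq with trans (sym (iter-absorbed succ² refl n (succ²-leaf m))) eq
  ... | ()

  succ¹-injective : InjOffE Tree succ¹
  succ¹-injective x y x∈ y∈ sx≢0 sy≢0 eq with succ¹-nonzero x∈ sx≢0 | succ¹-nonzero y∈ sy≢0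
  ... | a , refl | b , refl =
    cong spine (suc-injective (spine-injective (trans (sym (succ¹-spine a)) (trans eq (succ¹-spine b)))))

  succ²-injective : InjOffE Tree succ²
  succ²-injective x y x∈ y∈ sx≢0 sy≢0 eq with succ²-nonzero x∈ sx≢0 | succ²-nonzero y∈ sy≢0
  ... | a , refl , sa≡leaf | b , refl , sb≡leaf =
    cong spine (leaf-injective (trans (sym sa≡leaf) (trans eq sb≡leaf)))

  ran-disjoint : ∀ x y → Node x → Node y → succ¹ x ≡ succ² y → succ¹ x ≡ 0
  ran-disjoint x y x∈ y∈ eq with succ¹ x ≟ 0
  ... | yes s≡0 = s≡0
  ... | no  s≢0 with succ¹-nonzero x∈ s≢0 | succ²-nonzero y∈ (λ s²≡0 → s≢0 (trans eq s²≡0))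
  ...   | a , refl | b , refl , sb≡leaf =
    contradiction (trans (sym (succ¹-spine a)) (trans eq sb≡leaf)) spine≢leaf

  root∉ran¹ : ∀ {x} → Node x → succ¹ x ≢ spine 0
  root∉ran¹ x∈ eq with succ¹-nonzero x∈ (λ s≡0 → 0≢1+n (trans (sym s≡0) eq))
  ... | a , refl with spine-injective (trans (sym (succ¹-spine a)) eq)
  ...   | ()

  root∉ran² : ∀ {x} → Node x → succ² x ≢ spine 0
  root∉ran² x∈ eq with succ²-nonzero x∈ (λ s≡0 → 0≢1+n (trans (sym s≡0) eq))
  ... | a , refl , sa≡leaf = spine≢leaf (trans (sym eq) sa≡leaf)

  has-parent : ∀ z → Node z → z ≢ spine 0 →
               Σ ℕ λ x → Node x × ((succ¹ x ≡ z) ⊎ (succ² x ≡ z))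
  has-parent _ empty            _   = 0 , empty , inj₁ refl
  has-parent _ (spine∈ zero)    z≢r = contradiction refl z≢r
  has-parent _ (spine∈ (suc a)) _   = spine a , spine∈ a , inj₁ (succ¹-spine a)
  has-parent _ (leaf∈ a da≡1)   _   =
    spine a , spine∈ a , inj₂ (trans (succ²-spine a) (cong (λ v → ifz v 0 (leaf a)) da≡1))

  Tree-isBST : IsBST Tree
  Tree-isBST = record
    { noCyc¹ = succ¹-noCycles ; noCyc² = succ²-noCycles
    ; inj¹ = succ¹-injective ; inj² = succ²-injective
    ; disj = ran-disjoint ; ranNoR = λ x x∈ → root∉ran¹ x∈ , root∉ran² x∈ ; ranAll = has-parent
    ; S¹e = refl ; S²e = refl }

  Tree-infinite : Infinite Node
  Tree-infinite n = spine n , ≤-trans (≤-pairˡ n 0) (n≤1+n (pair n 0)) , spine∈ n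

  member-sound : ∀ x → Node x → member x ≡ 1
  member-sound _ empty          = refl
  member-sound _ (spine∈ n)     = member-spine n
  member-sound _ (leaf∈ n dn≡1) = trans (member-leaf n) dn≡1

  member-complete : ∀ x → member x ≡ 1 → Node x
  member-complete zero    _   = empty
  member-complete (suc y) m≡1 with π₂ y in eq
  ... | zero        = subst Node (cong suc (pair-π-at eq)) (spine∈ (π₁ y))
  ... | suc zero    = subst Node (cong suc (pair-π-at eq)) (leaf∈ (π₁ y) m≡1)
  ... | suc (suc _) = contradiction m≡1 0≢1+n

  Tree-computable : IsComputable d → IsComputableStr Tree
  Tree-computable d-computable =
    (member , oracleApply d-computable memberE index , λ x → member-sound x , member-complete x) ,
    oracleApply d-computable succ¹E index ,
    oracleApply d-computable succ²E index

  punctual-copy⇒primRec : ∀ {B} → IsPunctualStr B → Tree ≅ B → IsPrimRec d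
  punctual-copy⇒primRec {B} (_ , (p¹ , p¹-correct) , (p² , p²-correct)) iso =
    compile testE , λ n → trans (compile-correct testE (n ∷ [])) (testE-correct n)
    where
    open _≅_ iso

    imageE testE : Expr 1
    imageE = prog p² (`iter (var (# 0)) (lit (r B)) (prog p¹ (var (# 0))))
    testE  = `ifz (imageE `∸ lit (e B)) (`ifz (lit (e B) `∸ imageE) (lit 0) (lit 1)) (lit 1)

    to-spine : ∀ n → to (spine n) ≡ iter (S¹ B) n (r B)
    to-spine zero    = pres-r
    to-spine (suc n) = begin
      to (spine (suc n))       ≡⟨ cong to (succ¹-spine n) ⟨
      to (succ¹ (spine n))     ≡⟨ pres-S¹ (spine n) (spine∈ n) ⟩
      S¹ B (to (spine n))      ≡⟨ cong (S¹ B) (to-spine n) ⟩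
      iter (S¹ B) (suc n) (r B) ∎
      where open ≡-Reasoning

    imageE-correct : ∀ n → ⟦ imageE ⟧ (n ∷ []) ≡ to (succ² (spine n))
    imageE-correct n = begin
      evalPR p² (iter (λ s → evalPR p¹ (s ∷ [])) n (r B) ∷ []) ≡⟨ p²-correct _ ⟩
      S² B (iter (λ s → evalPR p¹ (s ∷ [])) n (r B))           ≡⟨ cong (S² B) (iter-cong p¹-correct n (r B)) ⟩
      S² B (iter (S¹ B) n (r B))                               ≡⟨ cong (S² B) (to-spine n) ⟨
      S² B (to (spine n))                                      ≡⟨ pres-S² (spine n) (spine∈ n) ⟨
      to (succ² (spine n))                                     ∎
      where open ≡-Reasoning

    testE-correct : ∀ n → ⟦ testE ⟧ (n ∷ []) ≡ d n
    testE-correct n with succ²-spine-cases n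
    ... | inj₁ (s≡0 , dn≡0) =
      trans (cong (λ v → differ v (e B)) (trans (imageE-correct n) (trans (cong to s≡0) pres-e)))
            (trans (differ-refl (e B)) (sym dn≡0))
    ... | inj₂ (s≡leaf , dn≡1) = trans (differ-≢ image≢e) (sym dn≡1)
      where
      image≢e : ⟦ imageE ⟧ (n ∷ []) ≢ e B
      image≢e image≡e = 0≢1+n (begin
        0                    ≡⟨ from-to 0 empty ⟨
        from (to 0)          ≡⟨ cong from pres-e ⟩
        from (e B)           ≡⟨ cong from (trans (sym image≡e) (trans (imageE-correct n) (cong to s≡leaf))) ⟩
        from (to (leaf n))   ≡⟨ from-to (leaf n) (leaf∈ n dn≡1) ⟩
        leaf n               ∎)
        where open ≡-Reasoning

open SpineTree diag diag-01

theorem27 : Σ Str λ A → IsBST A × Infinite (Dom A) × IsComputableStr A ×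
    (¬ (Σ Str λ B → IsBST B × IsPunctualStr B × (A ≅ B)))
theorem27 = Tree , Tree-isBST , Tree-infinite , Tree-computable diag-computable , not-punctual
  where
  not-punctual : ¬ (Σ Str λ B → IsBST B × IsPunctualStr B × (Tree ≅ B))
  not-punctual (_ , _ , punctual , Tree≅B) = diag-not-primRec (punctual-copy⇒primRec punctual Tree≅B)
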